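{- If $\mathcal{P}\subset\mathcal{A}^{\mathbb{N}}$ is a path set and $n\ge1$, then $H_{top}(\mathcal{P}^{(*n)})=H_{top}(\mathcal{P})$.
   Context: $\mathcal{A}$ is a finite alphabet. A path set is a subset of $\mathcal{A}^{\mathbb{N}}$ equal to the set of label sequences of all infinite directed walks starting at a marked vertex $v$ in some finite directed graph with edges labeled by symbols of $\mathcal{A}$. For $n\ge1$, the $n$-interleaving of $\mathcal{P}$ is $\mathcal{P}^{(*n)}=\{(x_i)_{i\ge0}\in\mathcal{A}^{\mathbb{N}}: (x_j,x_{j+n},x_{j+2n},\dots)\in\mathcal{P}\text{ for all }0\le j\le n-1\}$. The topological entropy of $\mathcal{P}$ is $H_{top}(\mathcal{P})=\limsup_{N\to\infty}\frac1N\log N_N(\mathcal{P})$, where $N_N(\mathcal{P})$ is the number of distinct words of length $N$ occurring as consecutive blocks in elements of $\mathcal{P}$. -}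

module Defs where

open import Data.Nat using (ℕ; zero; suc; _+_; _*_; _^_; _≤_; _<_)
open import Data.Fin using (Fin; toℕ)
open import Data.Vec using (Vec; lookup)
open import Data.List using (List; length)
open import Data.List.Relation.Unary.All using (All)
open import Data.List.Relation.Unary.Unique.Propositional using (Unique)
open import Data.List.Membership.Propositional using (_∈_)
open import Data.Product using (Σ; ∃; _×_; _,_)
open import Function.Bundles using (_⇔_)
open import Relation.Binary.PropositionalEquality using (_≡_)

Seq : ℕ → Set
Seq k = ℕ → Fin k

SeqSet : ℕ → Set₁
SeqSet k = Seq k → Set

-- A finite directed graph with edges labelled by Fin k:
-- V vertices, edges listed as triples (source , label , target).
record LabelledGraph (k : ℕ) : Set where
  field
    V     : ℕ
    edges : List (Fin V × Fin k × Fin V)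

open LabelledGraph public

IsWalkLabel : ∀ {k} (G : LabelledGraph k) → Fin (V G) → Seq k → Set
IsWalkLabel G v x =
  Σ (ℕ → Fin (V G)) λ s → (s 0 ≡ v) × (∀ i → (s i , x i , s (suc i)) ∈ edges G)

IsPathSet : ∀ {k} → SeqSet k → Set
IsPathSet {k} P =
  Σ (LabelledGraph k) λ G → Σ (Fin (V G)) λ v → ∀ x → P x ⇔ IsWalkLabel G v x

Interleave : ∀ {k} → ℕ → SeqSet k → SeqSet k
Interleave n P x = ∀ j → j < n → P (λ i → x (j + i * n))

Occurs : ∀ {k} → SeqSet k → ∀ {N} → Vec (Fin k) N → Set
Occurs {k} P {N} w =
  Σ (Seq k) λ x → P x × Σ ℕ λ p → ∀ (i : Fin N) → lookup w i ≡ x (p + toℕ i)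

-- N_N(P) · b^N ≤ a^N, i.e. N_N(P) ≤ (a/b)^N, expressed as: every list of
-- distinct length-N words occurring in P has length ℓ with ℓ · b^N ≤ a^N.
CountBelow : ∀ {k} → SeqSet k → (N a b : ℕ) → Set
CountBelow {k} P N a b =
  ∀ (ws : List (Vec (Fin k) N)) → Unique ws → All (Occurs P) ws →
    length ws * b ^ N ≤ a ^ N

EventuallyBelow : ∀ {k} → SeqSet k → (a b : ℕ) → Set
EventuallyBelow P a b = Σ ℕ λ N₀ → ∀ N → N₀ ≤ N → CountBelow P N a b

-- With L(P) = limsup N_N(P)^{1/N} we have
-- H_top(P) = log L(P) (log 0 = -∞), and L(P) ≤ L(Q) iff for every positive
-- rational a/b that is eventually an N-th-root upper bound for Q, every
-- strictly larger rational c/d is eventually an N-th-root upper bound for P.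
EntropyLe : ∀ {k} → SeqSet k → SeqSet k → Set
EntropyLe P Q =
  ∀ a b → 1 ≤ b → EventuallyBelow Q a b →
  ∀ c d → 1 ≤ d → a * d < c * b → EventuallyBelow P c d

EntropyEq : ∀ {k} → SeqSet k → SeqSet k → Set
EntropyEq P Q = EntropyLe P Q × EntropyLe Q P

{-# OPTIONS --safe #-}
-- H(P^(*n)) ≤ H(P) holds for every P: a word of length N occurring in P^(*n) is a prefix of one of
-- length M n with M = ⌊N/n⌋ + 1, which de-interleaves into n words of length M occurring in P, so
-- N_N(P^(*n)) ≤ N_M(P)^n.
-- The converse uses the graph. Classify the words of length N occurring in P by the vertex u at which
-- they are read. Any n words read from a common u, each spliced after one fixed walk from v to u,
-- interleave into a word of length N n occurring in P^(*n); so there are at most N_{Nn}(P^(*n))^{1/n}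
-- of them, and N_N(P) ≤ |V| · N_{Nn}(P^(*n))^{1/n}.
-- The constant factors lost on the way do not change the exponential growth rate.
module Submission where

open import Defs
open import Data.Nat using (ℕ; zero; suc; _+_; _*_; _^_; _∸_; _≤_; _<_; _⊔_; z≤n; s≤s; NonZero; >-nonZero)
open import Data.Nat.Properties
open import Data.Nat.DivMod
open import Data.Nat.Divisibility using (n∣m*n)
open import Data.Nat.Tactic.RingSolver using (solve-∀)
open import Data.Fin using (Fin; toℕ; fromℕ<; inject≤; combine; remQuot)
open import Data.Fin.Properties
  using (toℕ-fromℕ<; toℕ-injective; toℕ-inject≤; toℕ<n; toℕ-combine; combine-remQuot; remQuot-combine)
  renaming (_≟_ to _≟ᶠ_)
open import Data.Vec using (Vec; []; _∷_; lookup; tabulate)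
open import Data.Vec.Properties using (lookup∘tabulate; tabulate∘lookup; tabulate-cong; ∷-injective; ≡-dec)
import Data.Vec.Relation.Unary.All as VecAll
import Data.Vec.Relation.Unary.All.Properties as VecAllₚ
open import Data.List
  using (List; []; _∷_; [_]; length; map; _++_; cartesianProduct; cartesianProductWith; deduplicate)
open import Data.List.Properties using (length-++; length-map)
open import Data.List.Relation.Unary.All as All using (All; []; _∷_)
import Data.List.Relation.Unary.All.Properties as Allₚ
open import Data.List.Relation.Unary.Any using (here; there)
open import Data.List.Relation.Unary.Unique.Propositional using (Unique; []; _∷_)
import Data.List.Relation.Unary.Unique.Propositional.Properties as Uniqueₚ
import Data.List.Relation.Unary.Unique.DecPropositional.Properties as UniqueDecₚ
open import Data.List.Relation.Binary.Sublist.Propositional using ([]; _∷_; _∷ʳ_) renaming (_⊆_ to _⊑_)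
open import Data.List.Relation.Binary.Sublist.Propositional.Properties using (All-resp-⊆)
open import Data.List.Membership.Propositional using (_∈_)
open import Data.List.Membership.Propositional.Properties
open import Data.Product using (Σ; ∃; ∃₂; _×_; _,_; proj₁; proj₂)
open import Data.Sum using (inj₁; inj₂)
open import Data.Empty using (⊥-elim)
open import Function.Bundles using (_⇔_; Equivalence)
open import Relation.Nullary using (yes; no)
open import Relation.Unary using (_⊆_; _∪_; _⟨×⟩_)
open import Relation.Binary.Definitions using (DecidableEquality)
open import Relation.Binary.PropositionalEquality hiding ([_])

private
  variable
    A B : Set
    a a′ b b′ k n L M N : ℕ

-- Powers and eventual inequalities

^-distribʳ-* : ∀ m n o → (m * n) ^ o ≡ m ^ o * n ^ o
^-distribʳ-* m n zero    = refl
^-distribʳ-* m n (suc o) = begin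
  m * n * (m * n) ^ o        ≡⟨ cong (m * n *_) (^-distribʳ-* m n o) ⟩
  m * n * (m ^ o * n ^ o)    ≡⟨ interchange m n (m ^ o) (n ^ o) ⟩
  m * m ^ o * (n * n ^ o)    ∎
  where
  open ≡-Reasoning
  interchange : ∀ w x y z → w * x * (y * z) ≡ w * y * (x * z)
  interchange = solve-∀

^-cancelʳ-≤ : ∀ n .{{_ : NonZero n}} {x y} → x ^ n ≤ y ^ n → x ≤ y
^-cancelʳ-≤ n {x} {y} xⁿ≤yⁿ with x ≤? y
... | yes x≤y = x≤y
... | no  x≰y = ⊥-elim (<⇒≱ (^-monoˡ-< n (≰⇒> x≰y)) xⁿ≤yⁿ)

-- x times the first two terms of the binomial expansion of (x + 1) ^ N.
x^N*[x+N]≤x*[1+x]^N : ∀ x N → x ^ N * (x + N) ≤ x * suc x ^ N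
x^N*[x+N]≤x*[1+x]^N x zero = ≤-reflexive (unit-laws x)
  where
  unit-laws : ∀ x → 1 * (x + 0) ≡ x * 1
  unit-laws = solve-∀
x^N*[x+N]≤x*[1+x]^N x (suc N) = begin
  x * x ^ N * (x + suc N)              ≡⟨ split x (x ^ N) N ⟩
  x ^ N * (x + N) * x + x ^ N * x      ≤⟨ +-monoʳ-≤ (x ^ N * (x + N) * x) (*-monoʳ-≤ (x ^ N) (m≤m+n x N)) ⟩
  x ^ N * (x + N) * x + x ^ N * (x + N) ≡⟨ collect (x ^ N * (x + N)) x ⟩
  x ^ N * (x + N) * suc x              ≤⟨ *-monoˡ-≤ (suc x) (x^N*[x+N]≤x*[1+x]^N x N) ⟩
  x * suc x ^ N * suc x                ≡⟨ rearrange x (suc x ^ N) ⟩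
  x * (suc x * suc x ^ N)              ∎
  where
  open ≤-Reasoning
  split : ∀ x p N → x * p * (x + suc N) ≡ p * (x + N) * x + p * x
  split = solve-∀
  collect : ∀ q x → q * x + q ≡ q * suc x
  collect = solve-∀
  rearrange : ∀ x p → x * p * suc x ≡ x * (suc x * p)
  rearrange = solve-∀

Eventually : (ℕ → Set) → Set
Eventually Q = ∃ λ N₀ → ∀ N → N₀ ≤ N → Q N

eventually-zip : ∀ {Q R T : ℕ → Set} → Eventually Q → Eventually R → (∀ {N} → Q N → R N → T N) → Eventually T
eventually-zip (N₀ , q) (N₁ , r) f =
  N₀ ⊔ N₁ , λ N N₀⊔N₁≤N → f (q N (m⊔n≤o⇒m≤o N₀ N₁ N₀⊔N₁≤N)) (r N (m⊔n≤o⇒n≤o N₀ N₁ N₀⊔N₁≤N))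

K*x^N≤y^N-eventually : ∀ K {x y} → x < y → Eventually λ N → K * x ^ N ≤ y ^ N
K*x^N≤y^N-eventually K {zero} _ = 1 , λ { (suc N) _ → ≤-trans (≤-reflexive (*-zeroʳ K)) z≤n }
K*x^N≤y^N-eventually K {x@(suc _)} {y} x<y = K * x , λ N K*x≤N → *-cancelˡ-≤ x (begin
  x * (K * x ^ N)   ≡⟨ swap x K (x ^ N) ⟩
  x ^ N * (K * x)   ≤⟨ *-monoʳ-≤ (x ^ N) (≤-trans K*x≤N (m≤n+m N x)) ⟩
  x ^ N * (x + N)   ≤⟨ x^N*[x+N]≤x*[1+x]^N x N ⟩
  x * suc x ^ N     ≤⟨ *-monoʳ-≤ x (^-monoˡ-≤ N x<y) ⟩
  x * y ^ N         ∎)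
  where
  open ≤-Reasoning
  swap : ∀ x K p → x * (K * p) ≡ p * (K * x)
  swap = solve-∀

-- Cardinality bounds

Unique-resp-⊑ : ∀ {xs ys : List A} → xs ⊑ ys → Unique ys → Unique xs
Unique-resp-⊑ []             []        = []
Unique-resp-⊑ (y ∷ʳ xs⊑ys)   (_ ∷ u)   = Unique-resp-⊑ xs⊑ys u
Unique-resp-⊑ (refl ∷ xs⊑ys) (x∉ ∷ u)  = All-resp-⊆ xs⊑ys x∉ ∷ Unique-resp-⊑ xs⊑ys u

∈⇒∃-removal : ∀ {x : A} {ys} → x ∈ ys →
              ∃ λ zs → length ys ≡ suc (length zs) × (∀ {z} → z ∈ ys → z ≢ x → z ∈ zs)
∈⇒∃-removal {x = x} x∈ with ys₁ , ys₂ , refl ← ∈-∃++ x∈ = ys₁ ++ ys₂ , length-eq , ∈-removal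
  where
  length-eq : length (ys₁ ++ x ∷ ys₂) ≡ suc (length (ys₁ ++ ys₂))
  length-eq = begin
    length (ys₁ ++ x ∷ ys₂)          ≡⟨ length-++ ys₁ ⟩
    length ys₁ + suc (length ys₂)    ≡⟨ +-suc (length ys₁) (length ys₂) ⟩
    suc (length ys₁ + length ys₂)    ≡⟨ cong suc (length-++ ys₁) ⟨
    suc (length (ys₁ ++ ys₂))        ∎
    where open ≡-Reasoning
  ∈-removal : ∀ {z} → z ∈ ys₁ ++ x ∷ ys₂ → z ≢ x → z ∈ ys₁ ++ ys₂
  ∈-removal z∈ z≢x with ∈-++⁻ ys₁ z∈
  ... | inj₁ z∈ys₁         = ∈-++⁺ˡ z∈ys₁
  ... | inj₂ (here refl)   = ⊥-elim (z≢x refl)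
  ... | inj₂ (there z∈ys₂) = ∈-++⁺ʳ ys₁ z∈ys₂

Unique∧⊆⇒length≤ : ∀ (xs : List A) {ys} → Unique xs → (∀ {z} → z ∈ xs → z ∈ ys) → length xs ≤ length ys
Unique∧⊆⇒length≤ []       _        _     = z≤n
Unique∧⊆⇒length≤ (x ∷ xs) (x∉ ∷ u) xs⊆ys with zs , length-eq , removal ← ∈⇒∃-removal (xs⊆ys (here refl)) =
  subst (suc (length xs) ≤_) (sym length-eq)
    (s≤s (Unique∧⊆⇒length≤ xs u λ z∈ → removal (xs⊆ys (there z∈)) λ { refl → All.lookup x∉ z∈ refl }))

length-cartesianProductWith : ∀ {C : Set} (f : A → B → C) xs ys →
                              length (cartesianProductWith f xs ys) ≡ length xs * length ys
length-cartesianProductWith f []       ys = refl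
length-cartesianProductWith f (x ∷ xs) ys = begin
  length (map (f x) ys ++ cartesianProductWith f xs ys)          ≡⟨ length-++ (map (f x) ys) ⟩
  length (map (f x) ys) + length (cartesianProductWith f xs ys)
    ≡⟨ cong₂ _+_ (length-map (f x) ys) (length-cartesianProductWith f xs ys) ⟩
  length ys + length xs * length ys                              ∎
  where open ≡-Reasoning

tuples : List A → ∀ n → List (Vec A n)
tuples xs zero    = [ [] ]
tuples xs (suc n) = cartesianProductWith _∷_ xs (tuples xs n)

length-tuples : ∀ (xs : List A) n → length (tuples xs n) ≡ length xs ^ n
length-tuples xs zero    = refl
length-tuples xs (suc n) =
  trans (length-cartesianProductWith _∷_ xs (tuples xs n)) (cong (length xs *_) (length-tuples xs n))

tuples⁺-Unique : ∀ {xs : List A} n → Unique xs → Unique (tuples xs n)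
tuples⁺-Unique zero    _ = [] ∷ []
tuples⁺-Unique (suc n) u = Uniqueₚ.cartesianProductWith⁺ _∷_ ∷-injective u (tuples⁺-Unique n u)

tuples⁺-All : ∀ {S : A → Set} {xs} n → All S xs → All (VecAll.All S) (tuples xs n)
tuples⁺-All zero    _  = VecAll.[] ∷ []
tuples⁺-All {A = A} {xs = xs} (suc n) ss =
  Allₚ.cartesianProductWith⁺ (setoid A) (setoid (Vec A n)) _∷_ xs (tuples xs n)
    λ x∈ xs∈ → All.lookup ss x∈ VecAll.∷ All.lookup (tuples⁺-All n ss) xs∈

-- |S| · b ≤ a, with |S| seen only through duplicate-free lists of elements of S (S need not be decidable).
infix 4 ∣_∣*_≤_
∣_∣*_≤_ : (A → Set) → ℕ → ℕ → Set
∣ S ∣* b ≤ a = ∀ ws → Unique ws → All S ws → length ws * b ≤ a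

module _ {S : A → Set} where

  card-mono : ∀ {T} → S ⊆ T → ∣ T ∣* b ≤ a → ∣ S ∣* b ≤ a
  card-mono S⊆T bound ws u ss = bound ws u (All.map S⊆T ss)

  card-weaken : ∣ S ∣* b ≤ a → a ≤ a′ → b′ ≤ b → ∣ S ∣* b′ ≤ a′
  card-weaken bound a≤a′ b′≤b ws u ss = ≤-trans (*-monoʳ-≤ (length ws) b′≤b) (≤-trans (bound ws u ss) a≤a′)

  card-assuming : ∀ {R : Set} → (R → ∣ S ∣* b ≤ a) → ∣ (λ w → R × S w) ∣* b ≤ a
  card-assuming bound []       _ _              = z≤n
  card-assuming bound (w ∷ ws) u rss@((r , _) ∷ _) = bound r (w ∷ ws) u (All.map proj₂ rss)

  card-inject : ∀ {T : B → Set} (f : ∀ {w} → S w → Σ B T) (g : B → A) →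
                (∀ {w} (s : S w) → g (proj₁ (f {w} s)) ≡ w) → ∣ T ∣* b ≤ a → ∣ S ∣* b ≤ a
  card-inject {b = b} {a = a} f g g∘f≡id bound ws u ss =
    subst (λ l → l * b ≤ a) length-eq (bound (map proj₁ images) unique (All.fromList images))
    where
    images = All.reduce f ss
    retract : ∀ {ws} (ss : All S ws) → map g (map proj₁ (All.reduce f ss)) ≡ ws
    retract []       = refl
    retract (s ∷ ss) = cong₂ _∷_ (g∘f≡id s) (retract ss)
    length-eq : length (map proj₁ images) ≡ length ws
    length-eq = trans (sym (length-map g (map proj₁ images))) (cong length (retract ss))
    unique : Unique (map proj₁ images)
    unique = Uniqueₚ.map⁻ (subst Unique (sym (retract ss)) u)

  card-Vec⁻ : ∀ n .{{_ : NonZero n}} → ∣ VecAll.All S {n} ∣* b ^ n ≤ a ^ n → ∣ S ∣* b ≤ a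
  card-Vec⁻ {b = b} {a = a} n bound ws u ss = ^-cancelʳ-≤ n (begin
    (length ws * b) ^ n              ≡⟨ ^-distribʳ-* (length ws) b n ⟩
    length ws ^ n * b ^ n            ≡⟨ cong (_* b ^ n) (length-tuples ws n) ⟨
    length (tuples ws n) * b ^ n     ≤⟨ bound (tuples ws n) (tuples⁺-Unique n u) (tuples⁺-All n ss) ⟩
    a ^ n                            ∎)
    where open ≤-Reasoning

module _ {S T : A → Set} where

  partition-∪ : ∀ {ws} → All (S ∪ T) ws →
                ∃₂ λ ls rs → ls ⊑ ws × rs ⊑ ws × All S ls × All T rs × length ws ≡ length ls + length rs
  partition-∪ []            = [] , [] , [] , [] , [] , [] , refl
  partition-∪ (inj₁ s ∷ ss) with ls , rs , ls⊑ , rs⊑ , sls , trs , eq ← partition-∪ ss =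
    _ ∷ ls , rs , refl ∷ ls⊑ , _ ∷ʳ rs⊑ , s ∷ sls , trs , cong suc eq
  partition-∪ (inj₂ t ∷ ss) with ls , rs , ls⊑ , rs⊑ , sls , trs , eq ← partition-∪ ss =
    ls , _ ∷ rs , _ ∷ʳ ls⊑ , refl ∷ rs⊑ , sls , t ∷ trs ,
    trans (cong suc eq) (sym (+-suc (length ls) (length rs)))

  card-∪ : ∣ S ∣* b ≤ a → ∣ T ∣* b ≤ a′ → ∣ S ∪ T ∣* b ≤ a + a′
  card-∪ {b = b} {a = a} {a′ = a′} boundS boundT ws u sts
    with ls , rs , ls⊑ , rs⊑ , sls , trs , eq ← partition-∪ sts = begin
    length ws * b                    ≡⟨ cong (_* b) eq ⟩
    (length ls + length rs) * b      ≡⟨ *-distribʳ-+ b (length ls) (length rs) ⟩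
    length ls * b + length rs * b    ≤⟨ +-mono-≤ (boundS ls (Unique-resp-⊑ ls⊑ u) sls)
                                                 (boundT rs (Unique-resp-⊑ rs⊑ u) trs) ⟩
    a + a′                           ∎
    where open ≤-Reasoning

card-∃-Fin : ∀ {V} {S : Fin V → A → Set} → (∀ u → ∣ S u ∣* b ≤ a) → ∣ (λ w → ∃ λ u → S u w) ∣* b ≤ V * a
card-∃-Fin {V = zero}  bound []      _ []        = z≤n
card-∃-Fin {V = suc V} bound =
  card-mono (λ { (Fin.zero , s) → inj₁ s ; (Fin.suc u , s) → inj₂ (u , s) })
    (card-∪ (bound Fin.zero) (card-∃-Fin (λ u → bound (Fin.suc u))))

card-× : DecidableEquality A → DecidableEquality B → ∀ {S : A → Set} {T : B → Set} →
         ∣ S ∣* b ≤ a → ∣ T ∣* b′ ≤ a′ → ∣ S ⟨×⟩ T ∣* b * b′ ≤ a * a′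
card-× {b = b} {a = a} {b′ = b′} {a′ = a′} _≟ˡ_ _≟ʳ_ {S} {T} boundS boundT ps u sts = begin
  length ps * (b * b′)                       ≤⟨ *-monoˡ-≤ (b * b′) (Unique∧⊆⇒length≤ ps u ps⊆) ⟩
  length (cartesianProduct ls rs) * (b * b′) ≡⟨ cong (_* (b * b′)) (length-cartesianProductWith _,_ ls rs) ⟩
  length ls * length rs * (b * b′)           ≡⟨ interchange (length ls) (length rs) b b′ ⟩
  length ls * b * (length rs * b′)           ≤⟨ *-mono-≤ (boundS ls (UniqueDecₚ.deduplicate-! _≟ˡ_ _) sls)
                                                         (boundT rs (UniqueDecₚ.deduplicate-! _≟ʳ_ _) trs) ⟩
  a * a′                                     ∎
  where
  open ≤-Reasoning
  ls = deduplicate _≟ˡ_ (map proj₁ ps)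
  rs = deduplicate _≟ʳ_ (map proj₂ ps)
  ps⊆ : ∀ {p} → p ∈ ps → p ∈ cartesianProduct ls rs
  ps⊆ p∈ = ∈-cartesianProduct⁺ (∈-deduplicate⁺ _≟ˡ_ (∈-map⁺ proj₁ p∈)) (∈-deduplicate⁺ _≟ʳ_ (∈-map⁺ proj₂ p∈))
  sls : All S ls
  sls = Allₚ.deduplicate⁺ _≟ˡ_ (Allₚ.map⁺ (All.map proj₁ sts))
  trs : All T rs
  trs = Allₚ.deduplicate⁺ _≟ʳ_ (Allₚ.map⁺ (All.map proj₂ sts))
  interchange : ∀ w x y z → w * x * (y * z) ≡ w * y * (x * z)
  interchange = solve-∀

card-Vec : DecidableEquality A → ∀ {S : A → Set} → ∣ S ∣* b ≤ a → ∀ n → ∣ VecAll.All S {n} ∣* b ^ n ≤ a ^ n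
card-Vec _≟_ bound zero ws u _ =
  subst (_≤ 1) (sym (*-identityʳ (length ws))) (Unique∧⊆⇒length≤ ws {[ [] ]} u λ { {[]} _ → here refl })
card-Vec _≟_ bound (suc n) =
  card-inject (λ { {x ∷ xs} (s VecAll.∷ ss) → (x , xs) , s , ss }) (λ (x , xs) → x ∷ xs)
              (λ { (_ VecAll.∷ _) → refl })
              (card-× _≟_ (≡-dec _≟_) bound (card-Vec _≟_ bound n))

-- Entropy comparison up to constant factors

EventuallyBelowUpTo : ℕ → SeqSet k → ℕ → ℕ → Set
EventuallyBelowUpTo K P a b = Eventually λ N → ∣ Occurs P {N} ∣* b ^ N ≤ K * a ^ N

eventuallyBelow-absorb : ∀ {c d} K {P : SeqSet k} → EventuallyBelowUpTo K P a b → 1 ≤ b → a * d < c * b →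
                         EventuallyBelow P c d
eventuallyBelow-absorb {a = a} {b = b@(suc _)} {c} {d} K P-below _ ad<cb =
  eventually-zip P-below (K*x^N≤y^N-eventually K ad<cb) λ {N} bound K[ad]ᴺ≤[cb]ᴺ ws u ss →
    *-cancelʳ-≤ (length ws * d ^ N) (c ^ N) (b ^ N) {{m^n≢0 b N}} (begin
      length ws * d ^ N * b ^ N    ≡⟨ swap (length ws) (d ^ N) (b ^ N) ⟩
      length ws * b ^ N * d ^ N    ≤⟨ *-monoˡ-≤ (d ^ N) (bound ws u ss) ⟩
      K * a ^ N * d ^ N            ≡⟨ trans (*-assoc K (a ^ N) (d ^ N)) (cong (K *_) (sym (^-distribʳ-* a d N))) ⟩
      K * (a * d) ^ N              ≤⟨ K[ad]ᴺ≤[cb]ᴺ ⟩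
      (c * b) ^ N                  ≡⟨ ^-distribʳ-* c b N ⟩
      c ^ N * b ^ N                ∎)
  where
  open ≤-Reasoning
  swap : ∀ l x y → l * x * y ≡ l * y * x
  swap = solve-∀

entropyLe-upToConstant : ∀ {P Q : SeqSet k} →
                         (∀ {a b} → 1 ≤ b → EventuallyBelow Q a b → ∃ λ K → EventuallyBelowUpTo K P a b) →
                         EntropyLe P Q
entropyLe-upToConstant bound a b 1≤b Q-below c d _ ad<cb =
  let K , P-below = bound 1≤b Q-below in eventuallyBelow-absorb K P-below 1≤b ad<cb

-- Interleaving

module _ {N n : ℕ} where

  interleave : Vec (Vec A N) n → Vec A (N * n)
  interleave rows = tabulate λ i → let m , j = remQuot {N} n i in lookup (lookup rows j) m

  deinterleave : Vec A (N * n) → Vec (Vec A N) n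
  deinterleave w = tabulate λ j → tabulate λ m → lookup w (combine m j)

  ∀-combine : ∀ {Q : Fin (N * n) → Set} → (∀ (m : Fin N) (j : Fin n) → Q (combine m j)) → ∀ i → Q i
  ∀-combine {Q} Q-combine i = let m , j = remQuot {N} n i in subst Q (combine-remQuot {N} n i) (Q-combine m j)

  lookup-interleave : ∀ (rows : Vec (Vec A N) n) m j →
                      lookup (interleave rows) (combine m j) ≡ lookup (lookup rows j) m
  lookup-interleave rows m j = trans (lookup∘tabulate _ (combine m j))
    (cong (λ (m , j) → lookup (lookup rows j) m) (remQuot-combine {N} {n} m j))

  lookup-deinterleave : ∀ (w : Vec A (N * n)) j m →
                        lookup (lookup (deinterleave w) j) m ≡ lookup w (combine m j)
  lookup-deinterleave w j m = trans (cong (λ row → lookup row m) (lookup∘tabulate _ j)) (lookup∘tabulate _ m)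

  deinterleave-interleave : ∀ (rows : Vec (Vec A N) n) → deinterleave (interleave rows) ≡ rows
  deinterleave-interleave rows = trans
    (tabulate-cong λ j →
      trans (tabulate-cong λ m → lookup-interleave rows m j) (tabulate∘lookup (lookup rows j)))
    (tabulate∘lookup rows)

  interleave-deinterleave : ∀ (w : Vec A (N * n)) → interleave (deinterleave w) ≡ w
  interleave-deinterleave w = trans
    (tabulate-cong λ i → let m , j = remQuot {N} n i in
      trans (lookup-deinterleave w j m) (cong (lookup w) (combine-remQuot {N} n i)))
    (tabulate∘lookup w)

module _ (n : ℕ) .{{_ : NonZero n}} where

  interleaveˢ : (Fin n → ℕ → A) → ℕ → A
  interleaveˢ z i = z (i mod n) (i / n)

  interleaveˢ-at : ∀ (z : Fin n → ℕ → A) j i → interleaveˢ z (toℕ j + i * n) ≡ z j i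
  interleaveˢ-at z j i = cong₂ z (toℕ-injective mod-eq) div-eq
    where
    mod-eq : toℕ ((toℕ j + i * n) mod n) ≡ toℕ j
    mod-eq = trans (toℕ-fromℕ< _) (trans ([m+kn]%n≡m%n (toℕ j) i n) (m<n⇒m%n≡m (toℕ<n j)))
    div-eq : (toℕ j + i * n) / n ≡ i
    div-eq = trans (+-distrib-/-∣ʳ (toℕ j) (n∣m*n i)) (cong₂ _+_ (m<n⇒m/n≡0 (toℕ<n j)) (m*n/n≡m i n))

  p+[n*m+j]≡[p+j]%n+[[p+j]/n+m]*n : ∀ p m j → p + (n * m + j) ≡ (p + j) % n + ((p + j) / n + m) * n
  p+[n*m+j]≡[p+j]%n+[[p+j]/n+m]*n p m j = begin
    p + (n * m + j)                      ≡⟨ regroup p m j n ⟩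
    p + j + m * n                        ≡⟨ cong (_+ m * n) (m≡m%n+[m/n]*n (p + j) n) ⟩
    (p + j) % n + (p + j) / n * n + m * n ≡⟨ collect ((p + j) % n) ((p + j) / n) m n ⟩
    (p + j) % n + ((p + j) / n + m) * n  ∎
    where
    open ≡-Reasoning
    regroup : ∀ p m j n → p + (n * m + j) ≡ p + j + m * n
    regroup = solve-∀
    collect : ∀ r q m n → r + q * n + m * n ≡ r + (q + m) * n
    collect = solve-∀

  N≤[1+N/n]*n≤N+n : ∀ N → N ≤ suc (N / n) * n × suc (N / n) * n ≤ N + n
  N≤[1+N/n]*n≤N+n N =
    ≤-trans (≤-reflexive (m≡m%n+[m/n]*n N n)) (+-monoˡ-≤ (N / n * n) (m%n≤n N n)) ,
    ≤-trans (+-monoʳ-≤ n (m/n*n≤m N n)) (≤-reflexive (+-comm n N))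

a^m≤[1+a]^k*a^N : ∀ a {k m N} → N ≤ m → m ≤ N + k → a ^ m ≤ suc a ^ k * a ^ N
a^m≤[1+a]^k*a^N a {k} {m} {N} N≤m m≤N+k = begin
  a ^ m                   ≡⟨ cong (a ^_) (m+[n∸m]≡n N≤m) ⟨
  a ^ (N + (m ∸ N))       ≡⟨ ^-distribˡ-+-* a N (m ∸ N) ⟩
  a ^ N * a ^ (m ∸ N)     ≤⟨ *-monoʳ-≤ (a ^ N) (≤-trans (^-monoˡ-≤ (m ∸ N) (n≤1+n a))
                                                       (^-monoʳ-≤ (suc a) (m≤n+o⇒m∸n≤o m N m≤N+k))) ⟩
  a ^ N * suc a ^ k       ≡⟨ *-comm (a ^ N) (suc a ^ k) ⟩
  suc a ^ k * a ^ N       ∎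
  where open ≤-Reasoning

card-occurs-shorter : ∀ {P : SeqSet k} → N ≤ L → ∣ Occurs P {L} ∣* b ≤ a → ∣ Occurs P {N} ∣* b ≤ a
card-occurs-shorter {k = k} {N = N} {L = L} {P = P} N≤L =
  card-inject (λ {w} → extend {w}) prefix (λ {w} → prefix-extend {w})
  where
  block : Seq k → ℕ → Vec (Fin k) L
  block x p = tabulate λ i → x (p + toℕ i)
  extend : ∀ {w} → Occurs P {N} w → Σ (Vec (Fin k) L) (Occurs P)
  extend (x , x∈P , p , _) = block x p , x , x∈P , p , lookup∘tabulate (λ i → x (p + toℕ i))
  prefix : Vec (Fin k) L → Vec (Fin k) N
  prefix w = tabulate λ i → lookup w (inject≤ i N≤L)
  prefix-extend : ∀ {w : Vec (Fin k) N} (occ : Occurs P w) → prefix (proj₁ (extend {w} occ)) ≡ w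
  prefix-extend {w} (x , _ , p , w≡x) = trans
    (tabulate-cong λ i → begin
      lookup (block x p) (inject≤ i N≤L) ≡⟨ lookup∘tabulate (λ i → x (p + toℕ i)) (inject≤ i N≤L) ⟩
      x (p + toℕ (inject≤ i N≤L))        ≡⟨ cong (λ t → x (p + t)) (toℕ-inject≤ i N≤L) ⟩
      x (p + toℕ i)                      ≡⟨ w≡x i ⟨
      lookup w i                         ∎)
    (tabulate∘lookup w)
    where open ≡-Reasoning

module _ {P : SeqSet k} where

  deinterleave-occurs : ∀ {n} .{{_ : NonZero n}} {w : Vec (Fin k) (M * n)} →
                        Occurs (Interleave n P) w → VecAll.All (Occurs P) (deinterleave {N = M} {n} w)
  deinterleave-occurs {M = M} {n = n} {w = w} (y , y∈ , p , w≡y) = VecAllₚ.tabulate⁺ λ j →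
    let r = (p + toℕ j) % n ; q = (p + toℕ j) / n in
    (λ i → y (r + i * n)) , y∈ r (m%n<n (p + toℕ j) n) , q , λ m → begin
      lookup (tabulate λ m → lookup w (combine m j)) m ≡⟨ lookup∘tabulate (λ m → lookup w (combine m j)) m ⟩
      lookup w (combine m j)                          ≡⟨ w≡y (combine m j) ⟩
      y (p + toℕ (combine m j))                       ≡⟨ cong (λ t → y (p + t)) (toℕ-combine m j) ⟩
      y (p + (n * toℕ m + toℕ j))
        ≡⟨ cong y (p+[n*m+j]≡[p+j]%n+[[p+j]/n+m]*n n p (toℕ m) (toℕ j)) ⟩
      y (r + (q + toℕ m) * n)                         ∎
    where open ≡-Reasoning

  card-occurs-interleave : ∀ {n} .{{_ : NonZero n}} →
                           ∣ Occurs P {M} ∣* b ≤ a → ∣ Occurs (Interleave n P) {M * n} ∣* b ^ n ≤ a ^ n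
  card-occurs-interleave {M = M} {n = n} bound =
    card-inject (λ {w} occ → deinterleave w , deinterleave-occurs {w = w} occ) interleave
      (λ {w} _ → interleave-deinterleave {N = M} {n} w)
      (card-Vec (≡-dec _≟ᶠ_) bound n)

  interleave-entropyLe : ∀ n .{{_ : NonZero n}} → EntropyLe (Interleave n P) P
  interleave-entropyLe n = entropyLe-upToConstant λ {a} {b} 1≤b (N₀ , P-below) →
    suc a ^ n , N₀ * n , λ N N₀*n≤N →
      let M = suc (N / n) ; N≤M*n , M*n≤N+n = N≤[1+N/n]*n≤N+n n N
          N₀≤M = *-cancelʳ-≤ N₀ M n (≤-trans N₀*n≤N N≤M*n) in
      card-weaken
        (card-occurs-shorter N≤M*n (card-occurs-interleave (P-below M N₀≤M)))
        (≤-trans (≤-reflexive (^-*-assoc a M n)) (a^m≤[1+a]^k*a^N a N≤M*n M*n≤N+n))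
        (≤-trans (^-monoʳ-≤ b {{>-nonZero 1≤b}} N≤M*n) (≤-reflexive (sym (^-*-assoc b M n))))

-- Walks and path sets

infixr 5 _∷ˢ_
_∷ˢ_ : A → (ℕ → A) → ℕ → A
(c ∷ˢ y) zero    = c
(c ∷ˢ y) (suc i) = y i

splice : ℕ → (ℕ → A) → (ℕ → A) → ℕ → A
splice zero    x y = y
splice (suc q) x y = x 0 ∷ˢ splice q (λ i → x (suc i)) y

splice-shift : ∀ q (x y : ℕ → A) i → splice q x y (q + i) ≡ y i
splice-shift zero    x y i = refl
splice-shift (suc q) x y i = splice-shift q (λ i → x (suc i)) y i

module _ (G : LabelledGraph k) where

  StartsWalk : Fin (V G) → ∀ {N} → Vec (Fin k) N → Set
  StartsWalk u w = ∃ λ x → IsWalkLabel G u x × (∀ i → lookup w i ≡ x (toℕ i))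

  Reachable : Fin (V G) → Fin (V G) → Set
  Reachable v u = ∃ λ x → Σ (IsWalkLabel G v x) λ ω → ∃ λ q → proj₁ ω q ≡ u

  walk-resp-≗ : ∀ {u x y} → (∀ i → x i ≡ y i) → IsWalkLabel G u x → IsWalkLabel G u y
  walk-resp-≗ x≗y (s , s₀ , e) = s , s₀ , λ i → subst (λ c → (s i , c , s (suc i)) ∈ edges G) (x≗y i) (e i)

  walk-suffix : ∀ {u x} (ω : IsWalkLabel G u x) p → IsWalkLabel G (proj₁ ω p) (λ i → x (p + i))
  walk-suffix {x = x} (s , _ , e) p = (λ i → s (p + i)) , cong s (+-identityʳ p) ,
    λ i → subst (λ t → (s (p + i) , x (p + i) , s t) ∈ edges G) (sym (+-suc p i)) (e (p + i))

  walk-∷ : ∀ {u c w y} → (u , c , w) ∈ edges G → IsWalkLabel G w y → IsWalkLabel G u (c ∷ˢ y)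
  walk-∷ {u} e (s , refl , es) = u ∷ˢ s , refl , λ { zero → e ; (suc i) → es i }

  splice-walk : ∀ {u₀ u x y} q (ω : IsWalkLabel G u₀ x) → proj₁ ω q ≡ u → IsWalkLabel G u y →
                IsWalkLabel G u₀ (splice q x y)
  splice-walk {y = y} zero    (_ , s₀ , _) s₀≡u ω′ = subst (λ t → IsWalkLabel G t y) (trans (sym s₀≡u) s₀) ω′
  splice-walk         (suc q) ω@(_ , refl , e) sq≡u ω′ =
    walk-∷ (e 0) (splice-walk q (walk-suffix ω 1) sq≡u ω′)

module _ {P : SeqSet k} {G : LabelledGraph k} {v : Fin (V G)} (P⇔walk : ∀ x → P x ⇔ IsWalkLabel G v x) where

  private
    walk : ∀ {x} → P x → IsWalkLabel G v x
    walk = Equivalence.to (P⇔walk _)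

    unwalk : ∀ {x} → IsWalkLabel G v x → P x
    unwalk = Equivalence.from (P⇔walk _)

  pathSet-resp-≗ : ∀ {x y} → (∀ i → x i ≡ y i) → P x → P y
  pathSet-resp-≗ x≗y x∈P = unwalk (walk-resp-≗ G x≗y (walk x∈P))

  occurs⇒reachable∧startsWalk : ∀ {w : Vec (Fin k) N} → Occurs P w →
                                ∃ λ u → Reachable G v u × StartsWalk G u w
  occurs⇒reachable∧startsWalk (x , x∈P , p , w≡x) =
    let ω = walk x∈P in proj₁ ω p , (x , ω , p , refl) , (λ i → x (p + i)) , walk-suffix G ω p , w≡x

  -- All rows are spliced onto the same walk prefix from v to u, so they sit at the same offset q.
  interleave-occurs : ∀ n .{{_ : NonZero n}} {u} {rows : Vec (Vec (Fin k) N) n} →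
                      Reachable G v u → VecAll.All (StartsWalk G u) rows →
                      Occurs (Interleave n P) (interleave rows)
  interleave-occurs {N = N} n {rows = rows} (x , ω , q , ωq≡u) starts =
    y , y∈ , q * n , ∀-combine {Q = matches} match
    where
    row-seq : Fin n → Seq k
    row-seq j = proj₁ (VecAllₚ.lookup⁺ starts j)
    z : Fin n → Seq k
    z j = splice q x (row-seq j)
    z∈P : ∀ j → P (z j)
    z∈P j = unwalk (splice-walk G q ω ωq≡u (proj₁ (proj₂ (VecAllₚ.lookup⁺ starts j))))
    y : Seq k
    y = interleaveˢ n z
    y∈ : Interleave n P y
    y∈ j j<n = pathSet-resp-≗
      (λ i → trans (sym (interleaveˢ-at n z (fromℕ< j<n) i)) (cong (λ t → y (t + i * n)) (toℕ-fromℕ< j<n)))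
      (z∈P (fromℕ< j<n))
    matches : Fin (N * n) → Set
    matches i = lookup (interleave rows) i ≡ y (q * n + toℕ i)
    match : ∀ m j → matches (combine m j)
    match m j = begin
      lookup (interleave rows) (combine m j) ≡⟨ lookup-interleave rows m j ⟩
      lookup (lookup rows j) m               ≡⟨ proj₂ (proj₂ (VecAllₚ.lookup⁺ starts j)) m ⟩
      row-seq j (toℕ m)                      ≡⟨ splice-shift q x (row-seq j) (toℕ m) ⟨
      z j (q + toℕ m)                        ≡⟨ interleaveˢ-at n z j (q + toℕ m) ⟨
      y (toℕ j + (q + toℕ m) * n)
        ≡⟨ cong y (trans (regroup (toℕ j) q (toℕ m) n) (cong (q * n +_) (sym (toℕ-combine m j)))) ⟩
      y (q * n + toℕ (combine m j))          ∎
      where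
      open ≡-Reasoning
      regroup : ∀ j q m n → j + (q + m) * n ≡ q * n + (n * m + j)
      regroup = solve-∀

  card-startsWalk : ∀ n .{{_ : NonZero n}} {u} → Reachable G v u →
                    ∣ Occurs (Interleave n P) {N * n} ∣* b ^ (N * n) ≤ a ^ (N * n) →
                    ∣ StartsWalk G u {N} ∣* b ^ N ≤ a ^ N
  card-startsWalk {N = N} {b = b} {a = a} n reach bound = card-Vec⁻ n (card-weaken
    (card-inject (λ {rows} starts → interleave rows , interleave-occurs n reach starts) deinterleave
                 (λ {rows} _ → deinterleave-interleave rows) bound)
    (≤-reflexive (sym (^-*-assoc a N n)))
    (≤-reflexive (^-*-assoc b N n)))

  entropyLe-interleave : ∀ n .{{_ : NonZero n}} → EntropyLe P (Interleave n P)
  entropyLe-interleave n = entropyLe-upToConstant λ _ (N₀ , I-below) → V G , N₀ , λ N N₀≤N →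
    card-mono (λ {w} → occurs⇒reachable∧startsWalk {w = w}) (card-∃-Fin λ u → card-assuming λ reach →
      card-startsWalk n reach (I-below (N * n) (≤-trans N₀≤N (m≤m*n N n))))

proposition3p6 : (k : ℕ) (P : SeqSet k) → IsPathSet P →
                 (n : ℕ) → 1 ≤ n → EntropyEq (Interleave n P) P
proposition3p6 k P (G , v , P⇔walk) n@(suc _) _ = interleave-entropyLe n , entropyLe-interleave P⇔walk n
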